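{- For every integer $n \ge 0$ and every integer $k \ge 1$, the number of cliques of size $k$ in the $132$-core $D_n$ is $\binom{n+1}{2k}$.
   Context: For an integer $n \ge 0$, the $132$-core of size $n$ is the simple undirected graph $D_n$ with vertex set $\{(i,j) : 1 \le i \le j \le n\}$, in which two vertices $(i,j)$ and $(k,\ell)$ are adjacent if and only if either $i < k \le j < \ell$, or $k < i \le \ell < j$. ($D_0$ is the empty graph.) A clique of size $k$ is a set of $k$ pairwise adjacent vertices. -}

module Defs where

open import Data.Nat using (ℕ; zero; suc; _+_; _*_; _≤ᵇ_; _<ᵇ_)
open import Data.Bool using (Bool; true; false; _∧_; _∨_; T)
open import Data.Product using (_×_; _,_; Σ)
open import Data.List using (List; []; _∷_; length)
open import Relation.Binary.PropositionalEquality using (_≡_)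

Pair : Set
Pair = ℕ × ℕ

isVertex : ℕ → Pair → Bool
isVertex n (i , j) = (1 ≤ᵇ i) ∧ ((i ≤ᵇ j) ∧ (j ≤ᵇ n))

adjacent : Pair → Pair → Bool
adjacent (i , j) (k , l) =
  ((i <ᵇ k) ∧ ((k ≤ᵇ j) ∧ (j <ᵇ l))) ∨ ((k <ᵇ i) ∧ ((i ≤ᵇ l) ∧ (l <ᵇ j)))

-- Strict lexicographic order on pairs (used to represent a finite set of
-- vertices uniquely as a strictly increasing list).
lexLt : Pair → Pair → Bool
lexLt (i , j) (k , l) = (i <ᵇ k) ∨ ((i ≤ᵇ k) ∧ (k ≤ᵇ i) ∧ (j <ᵇ l))

allAbove : Pair → List Pair → Bool
allAbove p [] = true
allAbove p (q ∷ qs) = lexLt p q ∧ adjacent p q ∧ allAbove p qs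

isClique : ℕ → List Pair → Bool
isClique n [] = true
isClique n (p ∷ ps) = isVertex n p ∧ allAbove p ps ∧ isClique n ps

Clique : ℕ → ℕ → Set
Clique n k = Σ (List Pair) (λ c → T (isClique n c) × length c ≡ k)

-- List a clique of D_n in lexicographic order (i₁ , j₁) , … , (i_k , j_k). Pairwise
-- crossing of its vertices says exactly that i₁ < … < i_k, that j₁ < … < j_k and that
-- every i is at most every j; so, shifting the j's by one, the clique is the same thing
-- as the strictly increasing sequence i₁ < … < i_k < j₁ + 1 < … < j_k + 1 of numbers in
-- {1, …, n + 1}, i.e. a 2k-element subset of an (n + 1)-element set. Such subsets are
-- counted by Pascal's rule, splitting on whether the least candidate element is taken.
module Submission where

open import Defs
open import Data.Bool using (T; _∧_)
open import Data.Bool.Properties using (T-∧; T-∨; T-irrelevant)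
open import Data.Empty using (⊥-elim)
open import Data.Fin using (Fin)
open import Data.Fin.Properties using (1↔⊤; +↔⊎)
open import Data.List using (List; []; _∷_; length; map; _++_; take; drop; zip)
open import Data.List.Properties
  using (length-++; length-map; length-take; length-drop; map-∘; map-id-local; take++drop≡id)
open import Data.List.Relation.Unary.All as All using (All; []; _∷_)
import Data.List.Relation.Unary.All.Properties as Allₚ
open import Data.List.Relation.Unary.AllPairs as AllPairs using (AllPairs; []; _∷_)
import Data.List.Relation.Unary.AllPairs.Properties as AllPairsₚ
open import Data.Nat
open import Data.Nat.Properties
open import Data.Nat.Combinatorics using (_C_; nCk+nC[k+1]≡[n+1]C[k+1])
open import Data.Product using (Σ; _×_; _,_; proj₁; proj₂)
open import Data.Product.Function.NonDependent.Propositional using (_×-⇔_)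
open import Data.Sum using (_⊎_; inj₁; inj₂)
open import Data.Sum.Function.Propositional using (_⊎-↔_)
open import Data.Unit using (⊤; tt)
open import Function using (_∘_)
open import Function.Bundles using (_↔_; _⇔_; mk↔ₛ′; mk⇔; Equivalence)
open import Function.Construct.Composition using (_⇔-∘_; _↔-∘_)
open import Function.Properties.Inverse using (↔-sym)
open import Function.Related.Propositional using (module EquationalReasoning)
open import Level using (Level; 0ℓ)
open import Relation.Binary using (Rel)
open import Relation.Binary.PropositionalEquality
open import Relation.Nullary using (¬_; yes; no)
open import Relation.Nullary.Irrelevant using (Irrelevant)
open import Relation.Unary using (Pred)
import Relation.Unary as U

open Equivalence using (to; from)

private
  variable
    a b p q r : Level
    A : Set a
    B : Set b

×-irrelevant : Irrelevant A → Irrelevant B → Irrelevant (A × B)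
×-irrelevant A-irr B-irr (x , y) (x′ , y′) = cong₂ _,_ (A-irr x x′) (B-irr y y′)

Σ-≡ : {P : Pred A p} → U.Irrelevant P → {u v : Σ A P} → proj₁ u ≡ proj₁ v → u ≡ v
Σ-≡ P-irr {x , px} {.x , px′} refl = cong (x ,_) (P-irr px px′)

↔-restrict : {P : Pred A p} {Q : Pred B q} → U.Irrelevant P → U.Irrelevant Q →
             (f : A → B) (g : B → A) →
             (∀ x → P x → Q (f x)) → (∀ y → Q y → P (g y)) →
             (∀ x → P x → g (f x) ≡ x) → (∀ y → Q y → f (g y) ≡ y) →
             Σ A P ↔ Σ B Q
↔-restrict P-irr Q-irr f g f-pres g-pres g∘f f∘g = mk↔ₛ′
  (λ (x , px) → f x , f-pres x px)
  (λ (y , qy) → g y , g-pres y qy)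
  (λ (y , qy) → Σ-≡ Q-irr (f∘g y qy))
  (λ (x , px) → Σ-≡ P-irr (g∘f x px))

module _ {R : Rel A r} where

  AllPairs-++⁻ : ∀ xs {ys} → AllPairs R (xs ++ ys) →
                 AllPairs R xs × AllPairs R ys × All (λ x → All (R x) ys) xs
  AllPairs-++⁻ []       Rys         = [] , Rys , []
  AllPairs-++⁻ (x ∷ xs) (Rx ∷ Rxsys) =
    let Rxs , Rys , Rxs-ys = AllPairs-++⁻ xs Rxsys
        Rx-xs , Rx-ys      = Allₚ.++⁻ xs Rx
    in Rx-xs ∷ Rxs , Rys , Rx-ys ∷ Rxs-ys

  All²⇔diagonal×AllPairs : ∀ xs → All (λ x → All (R x) xs) xs ⇔
                           (All (λ x → R x x) xs × AllPairs (λ x y → R x y × R y x) xs)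
  All²⇔diagonal×AllPairs []       = mk⇔ (λ _ → [] , []) (λ _ → [])
  All²⇔diagonal×AllPairs (x ∷ xs) = mk⇔
    (λ { ((Rxx ∷ Rx-xs) ∷ rows) →
         let column , rows′ = All.unzipWith (λ { (Ryx ∷ Ry-xs) → Ryx , Ry-xs }) rows
             diagonal , pairs = to (All²⇔diagonal×AllPairs xs) rows′
         in Rxx ∷ diagonal , All.zip (Rx-xs , column) ∷ pairs })
    (λ { (Rxx ∷ diagonal , Rx-xs×column ∷ pairs) →
         let Rx-xs , column = All.unzip Rx-xs×column
             rows′ = from (All²⇔diagonal×AllPairs xs) (diagonal , pairs)
         in (Rxx ∷ Rx-xs) ∷ All.zipWith (λ (Ryx , Ry-xs) → Ryx ∷ Ry-xs) (column , rows′) })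

take-length-++ : ∀ (xs : List A) {ys} → take (length xs) (xs ++ ys) ≡ xs
take-length-++ []       = refl
take-length-++ (x ∷ xs) = cong (x ∷_) (take-length-++ xs)

drop-length-++ : ∀ (xs : List A) {ys} → drop (length xs) (xs ++ ys) ≡ ys
drop-length-++ []       = refl
drop-length-++ (x ∷ xs) = drop-length-++ xs

zip-map-proj₁-map-proj₂ : ∀ (ps : List (A × B)) → zip (map proj₁ ps) (map proj₂ ps) ≡ ps
zip-map-proj₁-map-proj₂ []       = refl
zip-map-proj₁-map-proj₂ (p ∷ ps) = cong (p ∷_) (zip-map-proj₁-map-proj₂ ps)

map-proj₁-zip : ∀ (xs : List A) (ys : List B) → length xs ≡ length ys →
                map proj₁ (zip xs ys) ≡ xs
map-proj₁-zip []       []       _   = refl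
map-proj₁-zip (x ∷ xs) (y ∷ ys) len = cong (x ∷_) (map-proj₁-zip xs ys (suc-injective len))

map-proj₂-zip : ∀ (xs : List A) (ys : List B) → length xs ≡ length ys →
                map proj₂ (zip xs ys) ≡ ys
map-proj₂-zip []       []       _   = refl
map-proj₂-zip (x ∷ xs) (y ∷ ys) len = cong (y ∷_) (map-proj₂-zip xs ys (suc-injective len))

InRange : ℕ → ℕ → Pred ℕ 0ℓ
InRange lo hi x = lo ≤ x × x < hi

Ascending : ℕ → ℕ → Pred (List ℕ) 0ℓ
Ascending lo hi xs = AllPairs _<_ xs × All (InRange lo hi) xs

Subset : ℕ → ℕ → ℕ → Set
Subset lo hi m = Σ (List ℕ) (λ xs → Ascending lo hi xs × length xs ≡ m)

Ascending-irrelevant : ∀ {lo hi} → U.Irrelevant (Ascending lo hi)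
Ascending-irrelevant =
  ×-irrelevant (AllPairs.irrelevant <-irrelevant) (All.irrelevant (×-irrelevant ≤-irrelevant <-irrelevant))

Subset-≡ : ∀ {lo hi m} {u v : Subset lo hi m} → proj₁ u ≡ proj₁ v → u ≡ v
Subset-≡ = Σ-≡ (×-irrelevant Ascending-irrelevant ≡-irrelevant)

Subset-zero↔⊤ : ∀ {lo hi} → Subset lo hi 0 ↔ ⊤
Subset-zero↔⊤ = mk↔ₛ′ (λ _ → tt) (λ _ → [] , ([] , []) , refl) (λ _ → refl) (λ { ([] , ([] , []) , refl) → refl })

Subset-empty : ∀ {lo hi m} → hi ≤ lo → ¬ Subset lo hi (suc m)
Subset-empty hi≤lo (x ∷ _ , (_ , (lo≤x , x<hi) ∷ _) , _) = <-irrefl refl (<-≤-trans x<hi (≤-trans hi≤lo lo≤x))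

Subset-pascal : ∀ {lo hi m} → lo < hi →
                Subset lo hi (suc m) ↔ (Subset (suc lo) hi m ⊎ Subset (suc lo) hi (suc m))
Subset-pascal {lo} {hi} {m} lo<hi = mk↔ₛ′ split join split∘join join∘split
  where
  tighten : ∀ {x xs} → lo ≤ x → All (x <_) xs → All (InRange lo hi) xs → All (InRange (suc lo) hi) xs
  tighten lo≤x x<xs xs-in = All.zipWith (λ (x<y , _ , y<hi) → ≤-<-trans lo≤x x<y , y<hi) (x<xs , xs-in)

  loosen : ∀ {xs} → All (InRange (suc lo) hi) xs → All (InRange lo hi) xs
  loosen = All.map (λ (lo<x , x<hi) → <⇒≤ lo<x , x<hi)

  split : Subset lo hi (suc m) → Subset (suc lo) hi m ⊎ Subset (suc lo) hi (suc m)
  split (x ∷ xs , (x<xs ∷ xs↑ , (lo≤x , x<hi) ∷ xs-in) , len) with lo ≟ x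
  ... | yes refl = inj₁ (xs , (xs↑ , tighten lo≤x x<xs xs-in) , suc-injective len)
  ... | no lo≢x  = inj₂ (x ∷ xs , (x<xs ∷ xs↑ , (≤∧≢⇒< lo≤x lo≢x , x<hi) ∷ tighten lo≤x x<xs xs-in) , len)

  join : Subset (suc lo) hi m ⊎ Subset (suc lo) hi (suc m) → Subset lo hi (suc m)
  join (inj₁ (xs , (xs↑ , xs-in) , len)) =
    lo ∷ xs , (All.map proj₁ xs-in ∷ xs↑ , (≤-refl , lo<hi) ∷ loosen xs-in) , cong suc len
  join (inj₂ (xs , (xs↑ , xs-in) , len)) = xs , (xs↑ , loosen xs-in) , len

  split∘join : ∀ s → split (join s) ≡ s
  split∘join (inj₁ _) with lo ≟ lo
  ... | yes refl  = cong inj₁ (Subset-≡ refl)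
  ... | no lo≢lo  = ⊥-elim (lo≢lo refl)
  split∘join (inj₂ (x ∷ _ , (_ ∷ _ , (lo<x , _) ∷ _) , _)) with lo ≟ x
  ... | yes refl = ⊥-elim (<-irrefl refl lo<x)
  ... | no _     = cong inj₂ (Subset-≡ refl)

  join∘split : ∀ s → join (split s) ≡ s
  join∘split (x ∷ _ , (_ ∷ _ , _ ∷ _) , _) with lo ≟ x
  ... | yes refl = Subset-≡ refl
  ... | no _     = Subset-≡ refl

Subset↔Fin : ∀ d {lo hi} → d + lo ≡ hi → ∀ m → Subset lo hi m ↔ Fin (d C m)
Subset↔Fin d       _    zero    = ↔-sym 1↔⊤ ↔-∘ Subset-zero↔⊤
Subset↔Fin zero    refl (suc m) =
  mk↔ₛ′ (⊥-elim ∘ Subset-empty ≤-refl) (λ ()) (λ ()) (⊥-elim ∘ Subset-empty ≤-refl)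
Subset↔Fin (suc d) {lo} {hi} d+lo≡hi (suc m) = begin
  Subset lo hi (suc m)                                  ↔⟨ Subset-pascal lo<hi ⟩
  (Subset (suc lo) hi m ⊎ Subset (suc lo) hi (suc m))   ↔⟨ Subset↔Fin d shifted m ⊎-↔ Subset↔Fin d shifted (suc m) ⟩
  (Fin (d C m) ⊎ Fin (d C suc m))                       ↔⟨ ↔-sym +↔⊎ ⟩
  Fin (d C m + d C suc m)                               ≡⟨ cong Fin (nCk+nC[k+1]≡[n+1]C[k+1] d m) ⟩
  Fin (suc d C suc m)                                   ∎
  where
  open EquationalReasoning
  shifted : d + suc lo ≡ hi
  shifted = trans (+-suc d lo) d+lo≡hi
  lo<hi : lo < hi
  lo<hi = subst (lo <_) d+lo≡hi (s≤s (m≤n+m lo d))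

Vertex : ℕ → Pred Pair 0ℓ
Vertex n (i , j) = 1 ≤ i × i ≤ j × j ≤ n

Crosses : Rel Pair 0ℓ
Crosses (i , j) (k , l) = i < k × k ≤ j × j < l

IsClique : ℕ → Pred (List Pair) 0ℓ
IsClique n c = All (Vertex n) c × AllPairs Crosses c

T-≤ᵇ : ∀ {m n} → T (m ≤ᵇ n) ⇔ m ≤ n
T-≤ᵇ = mk⇔ (≤ᵇ⇒≤ _ _) ≤⇒≤ᵇ

T-<ᵇ : ∀ {m n} → T (m <ᵇ n) ⇔ m < n
T-<ᵇ = mk⇔ (<ᵇ⇒< _ _) <⇒<ᵇ

T-isVertex : ∀ n p → T (isVertex n p) ⇔ Vertex n p
T-isVertex n (i , j) = (T-≤ᵇ ×-⇔ ((T-≤ᵇ ×-⇔ T-≤ᵇ) ⇔-∘ T-∧)) ⇔-∘ T-∧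

lexLt⇒≤ : ∀ i j k l → T (lexLt (i , j) (k , l)) → i ≤ k
lexLt⇒≤ _ _ _ _ lt with to T-∨ lt
... | inj₁ i<k    = <⇒≤ (to T-<ᵇ i<k)
... | inj₂ i≤k∧… = to T-≤ᵇ (proj₁ (to T-∧ i≤k∧…))

-- The second disjunct of adjacent is the first one with the two vertices swapped;
-- lexLt rules it out.
T-lexLt×adjacent : ∀ p q → (T (lexLt p q) × T (adjacent p q)) ⇔ Crosses p q
T-lexLt×adjacent (i , j) (k , l) = mk⇔
  (λ (lt , adj) → case-adjacent lt (to T-∨ adj))
  (λ crosses@(i<k , _) → from T-∨ (inj₁ (from T-<ᵇ i<k)) , from T-∨ (inj₁ (from T-crosses crosses)))
  where
  T-crosses : T ((i <ᵇ k) ∧ ((k ≤ᵇ j) ∧ (j <ᵇ l))) ⇔ Crosses (i , j) (k , l)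
  T-crosses = (T-<ᵇ ×-⇔ ((T-≤ᵇ ×-⇔ T-<ᵇ) ⇔-∘ T-∧)) ⇔-∘ T-∧
  case-adjacent : T (lexLt (i , j) (k , l)) →
                  T ((i <ᵇ k) ∧ ((k ≤ᵇ j) ∧ (j <ᵇ l))) ⊎ T ((k <ᵇ i) ∧ ((i ≤ᵇ l) ∧ (l <ᵇ j))) →
                  Crosses (i , j) (k , l)
  case-adjacent _  (inj₁ crosses) = to T-crosses crosses
  case-adjacent lt (inj₂ crossed) = ⊥-elim (<⇒≱ (to T-<ᵇ (proj₁ (to T-∧ crossed))) (lexLt⇒≤ i j k l lt))

T-allAbove : ∀ p qs → T (allAbove p qs) ⇔ All (Crosses p) qs
T-allAbove p []       = mk⇔ (λ _ → []) (λ _ → tt)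
T-allAbove p (q ∷ qs) = mk⇔
  (λ t → let lt , t′  = to T-∧ t
             adj , t″ = to T-∧ t′
         in to (T-lexLt×adjacent p q) (lt , adj) ∷ to (T-allAbove p qs) t″)
  (λ { (crosses ∷ cs) → let lt , adj = from (T-lexLt×adjacent p q) crosses
                        in from T-∧ (lt , from T-∧ (adj , from (T-allAbove p qs) cs)) })

T-isClique : ∀ n c → T (isClique n c) ⇔ IsClique n c
T-isClique n []       = mk⇔ (λ _ → [] , []) (λ _ → tt)
T-isClique n (p ∷ ps) = mk⇔
  (λ t → let v , t′     = to T-∧ t
             above , t″ = to T-∧ t′
             vs , cs    = to (T-isClique n ps) t″
         in to (T-isVertex n p) v ∷ vs , to (T-allAbove p ps) above ∷ cs)
  (λ { (v ∷ vs , above ∷ cs) →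
       from T-∧ (from (T-isVertex n p) v ,
                 from T-∧ (from (T-allAbove p ps) above , from (T-isClique n ps) (vs , cs))) })

-- The j's are shifted by one so that i_k ≤ j₁ becomes a strict inequality.
encode : List Pair → List ℕ
encode c = map proj₁ c ++ map (suc ∘ proj₂) c

decode : ℕ → List ℕ → List Pair
decode k xs = zip (take k xs) (map pred (drop k xs))

IsClique⇔Ascending-encode : ∀ n c → IsClique n c ⇔ Ascending 1 (2 + n) (encode c)
IsClique⇔Ascending-encode n c = mk⇔ clique⇒ascending ascending⇒clique
  where
  Below : Rel Pair 0ℓ
  Below p q = proj₁ p < suc (proj₂ q)

  clique⇒ascending : IsClique n c → Ascending 1 (2 + n) (encode c)
  clique⇒ascending (vs , cs) =
    AllPairsₚ.++⁺ i-ascending j-ascending i-below-j , Allₚ.++⁺ i-in j-in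
    where
    i-ascending : AllPairs _<_ (map proj₁ c)
    i-ascending = AllPairsₚ.map⁺ (AllPairs.map proj₁ cs)
    j-ascending : AllPairs _<_ (map (suc ∘ proj₂) c)
    j-ascending = AllPairsₚ.map⁺ (AllPairs.map (λ (_ , _ , j<l) → s<s j<l) cs)
    i-below-j : All (λ i → All (i <_) (map (suc ∘ proj₂) c)) (map proj₁ c)
    i-below-j = Allₚ.map⁺ (All.map Allₚ.map⁺ (from (All²⇔diagonal×AllPairs {R = Below} c)
      ( All.map (λ (_ , i≤j , _) → s≤s i≤j) vs
      , AllPairs.map (λ (i<k , k≤j , j<l) → s≤s (<⇒≤ (<-trans (<-≤-trans i<k k≤j) j<l)) , s≤s k≤j) cs)))
    i-in : All (InRange 1 (2 + n)) (map proj₁ c)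
    i-in = Allₚ.map⁺ (All.map (λ (1≤i , i≤j , j≤n) → 1≤i , s≤s (m≤n⇒m≤1+n (≤-trans i≤j j≤n))) vs)
    j-in : All (InRange 1 (2 + n)) (map (suc ∘ proj₂) c)
    j-in = Allₚ.map⁺ (All.map (λ (_ , _ , j≤n) → s≤s z≤n , s≤s (s≤s j≤n)) vs)

  ascending⇒clique : Ascending 1 (2 + n) (encode c) → IsClique n c
  ascending⇒clique (c↑ , c-in) =
    let i-ascending , j-ascending , i-below-j = AllPairs-++⁻ (map proj₁ c) c↑
        i-in , j-in = Allₚ.++⁻ (map proj₁ c) c-in
        diagonal , pairs =
          to (All²⇔diagonal×AllPairs {R = Below} c) (All.map Allₚ.map⁻ (Allₚ.map⁻ i-below-j))
    in All.zipWith (λ ((1≤i , _) , i<1+j , (_ , 1+j<2+n)) → 1≤i , s≤s⁻¹ i<1+j , s≤s⁻¹ (s≤s⁻¹ 1+j<2+n))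
                   (Allₚ.map⁻ i-in , All.zip (diagonal , Allₚ.map⁻ j-in)) ,
       AllPairs.zipWith (λ (i<k , (_ , k<1+j) , 1+j<1+l) → i<k , s≤s⁻¹ k<1+j , s<s⁻¹ 1+j<1+l)
                        (AllPairsₚ.map⁻ i-ascending , AllPairs.zip (pairs , AllPairsₚ.map⁻ j-ascending))

length-encode : ∀ c → length (encode c) ≡ 2 * length c
length-encode c = begin
  length (map proj₁ c ++ map (suc ∘ proj₂) c)          ≡⟨ length-++ (map proj₁ c) ⟩
  length (map proj₁ c) + length (map (suc ∘ proj₂) c)  ≡⟨ cong₂ _+_ (length-map proj₁ c) (length-map (suc ∘ proj₂) c) ⟩
  length c + length c                                  ≡⟨ cong (length c +_) (sym (+-identityʳ (length c))) ⟩
  2 * length c                                         ∎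
  where open ≡-Reasoning

decode-encode : ∀ c → decode (length c) (encode c) ≡ c
decode-encode c = begin
  decode (length c) (is ++ js)
    ≡⟨ cong (λ k → decode k (is ++ js)) (sym (length-map proj₁ c)) ⟩
  zip (take (length is) (is ++ js)) (map pred (drop (length is) (is ++ js)))
    ≡⟨ cong₂ (λ xs ys → zip xs (map pred ys)) (take-length-++ is) (drop-length-++ is) ⟩
  zip is (map pred js)
    ≡⟨ cong (zip is) (sym (map-∘ c)) ⟩
  zip is (map proj₂ c)
    ≡⟨ zip-map-proj₁-map-proj₂ c ⟩
  c ∎
  where
  open ≡-Reasoning
  is js : List ℕ
  is = map proj₁ c
  js = map (suc ∘ proj₂) c

module _ (k : ℕ) (xs : List ℕ) (len : length xs ≡ k + k) where

  length-take-half : length (take k xs) ≡ k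
  length-take-half = trans (length-take k xs) (trans (cong (k ⊓_) len) (m≤n⇒m⊓n≡m (m≤m+n k k)))

  length-drop-half : length (drop k xs) ≡ k
  length-drop-half = trans (length-drop k xs) (trans (cong (_∸ k) len) (m+n∸m≡n k k))

  halves-same-length : length (take k xs) ≡ length (map pred (drop k xs))
  halves-same-length = trans length-take-half (sym (trans (length-map pred (drop k xs)) length-drop-half))

  map-proj₁-decode : map proj₁ (decode k xs) ≡ take k xs
  map-proj₁-decode = map-proj₁-zip (take k xs) (map pred (drop k xs)) halves-same-length

  map-proj₂-decode : map proj₂ (decode k xs) ≡ map pred (drop k xs)
  map-proj₂-decode = map-proj₂-zip (take k xs) (map pred (drop k xs)) halves-same-length

  length-decode : length (decode k xs) ≡ k
  length-decode = begin
    length (decode k xs)            ≡⟨ length-map proj₁ (decode k xs) ⟨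
    length (map proj₁ (decode k xs)) ≡⟨ cong length map-proj₁-decode ⟩
    length (take k xs)              ≡⟨ length-take-half ⟩
    k                               ∎
    where open ≡-Reasoning

  encode-decode : All (1 ≤_) xs → encode (decode k xs) ≡ xs
  encode-decode positive = begin
    map proj₁ (decode k xs) ++ map (suc ∘ proj₂) (decode k xs)
      ≡⟨ cong₂ _++_ map-proj₁-decode (map-∘ (decode k xs)) ⟩
    take k xs ++ map suc (map proj₂ (decode k xs))
      ≡⟨ cong (λ ys → take k xs ++ map suc ys) map-proj₂-decode ⟩
    take k xs ++ map suc (map pred (drop k xs))
      ≡⟨ cong (take k xs ++_) (map-∘ (drop k xs)) ⟨
    take k xs ++ map (suc ∘ pred) (drop k xs)
      ≡⟨ cong (take k xs ++_) (map-id-local (All.map (λ { (s≤s _) → refl }) (Allₚ.drop⁺ k positive))) ⟩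
    take k xs ++ drop k xs
      ≡⟨ take++drop≡id k xs ⟩
    xs ∎
    where open ≡-Reasoning

Clique↔Subset : ∀ n k → Clique n k ↔ Subset 1 (2 + n) (2 * k)
Clique↔Subset n k = ↔-restrict (×-irrelevant T-irrelevant ≡-irrelevant)
                               (×-irrelevant Ascending-irrelevant ≡-irrelevant)
                               encode (decode k) encode-clique decode-subset decode∘encode encode∘decode
  where
  halves : ∀ {m} → m ≡ 2 * k → m ≡ k + k
  halves len = trans len (cong (k +_) (+-identityʳ k))

  encode-clique : ∀ c → T (isClique n c) × length c ≡ k →
                  Ascending 1 (2 + n) (encode c) × length (encode c) ≡ 2 * k
  encode-clique c (t , refl) = to (IsClique⇔Ascending-encode n c) (to (T-isClique n c) t) , length-encode c

  decode-subset : ∀ xs → Ascending 1 (2 + n) xs × length xs ≡ 2 * k →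
                  T (isClique n (decode k xs)) × length (decode k xs) ≡ k
  decode-subset xs (xs↑ , len) =
    from (T-isClique n (decode k xs)) (from (IsClique⇔Ascending-encode n (decode k xs))
      (subst (Ascending 1 (2 + n)) (sym (encode-decode k xs (halves len) (All.map proj₁ (proj₂ xs↑)))) xs↑)) ,
    length-decode k xs (halves len)

  decode∘encode : ∀ c → T (isClique n c) × length c ≡ k → decode k (encode c) ≡ c
  decode∘encode c (_ , refl) = decode-encode c

  encode∘decode : ∀ xs → Ascending 1 (2 + n) xs × length xs ≡ 2 * k → encode (decode k xs) ≡ xs
  encode∘decode xs (xs↑ , len) = encode-decode k xs (halves len) (All.map proj₁ (proj₂ xs↑))

mainTheorem1 : (n k : ℕ) → 1 ≤ k →
    Clique n k ↔ Fin ((suc n) C (2 * k))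
mainTheorem1 n k _ = Subset↔Fin (suc n) (+-comm (suc n) 1) (2 * k) ↔-∘ Clique↔Subset n k
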